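{- Fix a word length $n\ge 1$ and integers $m$ with $0\le m<n/2$ and $e,d\in\{0,1\}$. Let $x=e(01)^m d^{\,n-2m-1}$ (a binary word of length $n$, written most significant bit first) be the input of a program in the computational model described in the context. Define $k_0=n$ and $k_i=2(m-i)+1$ for $i\ge 1$. Then, at any point of the computation after exactly $i$ increment and decrement operations (in total) have been executed, every variable has the property that the $k_i$ most significant bits of its value lie in the set $\{0^{k_i},1^{k_i},x'\}$, where $x'$ denotes the $k_i$ most significant bits of the input $x$.
   Context: Computational model: a program operates on unsigned integer variables, each holding an $n$-bit word. The input word $x$ is stored in a variable $x$; all other variables are initially zero. The available operations are increment and decrement (modulo $2^n$, so incrementing $1^n$ gives $0^n$ and decrementing $0^n$ gives $1^n$), bitwise logical AND and OR, and assignment (copying a variable's value or assigning a constant). The only constant available in assignments and comparisons is zero. Control flow may depend on comparisons between variables or with zero, and the program eventually outputs the value of a variable. Words are written most significant bit first; $a^k$ denotes the word consisting of $k$ copies of the bit $a$. -}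

module Defs where

open import Data.Bool using (Bool; true; false; not; if_then_else_)
open import Data.Nat using (ℕ; zero; suc; _+_; _*_; _∸_; _<_; _≤_; _≟_; _<?_; _≤?_)
open import Data.Fin using (Fin)
import Data.Fin as Fin
open import Data.Vec using (Vec; []; _∷_; toList)
import Data.Vec as Vec
open import Data.Bool.ListAction using (and)
open import Data.List using (List; []; _∷_; foldl; take; replicate)
import Data.List as List
open import Data.Maybe using (Maybe; just; nothing)
open import Data.Sum using (_⊎_)
open import Relation.Binary.PropositionalEquality using (_≡_)
open import Relation.Nullary.Decidable using (⌊_⌋)

-- n-bit words, most significant bit first (true = 1, false = 0)

Word : ℕ → Set
Word n = Vec Bool n

zeroW : ∀ {n} → Word n
zeroW = Vec.replicate _ false

val : ∀ {n} → Word n → ℕ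
val w = foldl (λ acc b → 2 * acc + (if b then 1 else 0)) 0 (toList w)

inc : ∀ {n} → Word n → Word n
inc [] = []
inc (b ∷ bs) = if and (toList bs)
               then not b ∷ Vec.map (λ _ → false) bs
               else b ∷ inc bs

dec : ∀ {n} → Word n → Word n
dec [] = []
dec (b ∷ bs) = if and (List.map not (toList bs))
               then not b ∷ Vec.map (λ _ → true) bs
               else b ∷ dec bs

_∧w_ : ∀ {n} → Word n → Word n → Word n
_∧w_ = Vec.zipWith Data.Bool._∧_
  where import Data.Bool

_∨w_ : ∀ {n} → Word n → Word n → Word n
_∨w_ = Vec.zipWith Data.Bool._∨_
  where import Data.Bool

-- Programs over V variables (Fin V); variable Fin.zero holds the input.
-- The only constant is zero.

data Operand (V : ℕ) : Set where
  var  : Fin V → Operand V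
  zeroC : Operand V

data Cmp : Set where
  eqC neC ltC leC : Cmp

data Instr (V : ℕ) : Set where
  incI    : Fin V → Instr V
  decI    : Fin V → Instr V
  andI    : Fin V → Fin V → Fin V → Instr V
  orI     : Fin V → Fin V → Fin V → Instr V
  assignI : Fin V → Operand V → Instr V
  jumpIf  : Cmp → Operand V → Operand V → ℕ → Instr V
  outputI : Fin V → Instr V

Program : ℕ → Set
Program V = List (Instr V)

record Config (n V : ℕ) : Set where
  constructor ⟨_,_⟩
  field
    pc    : ℕ
    store : Fin V → Word n
open Config public

initial : ∀ {n V} → Word n → Config n (suc V)
initial x = ⟨ 0 , (λ u → if ⌊ u Fin.≟ Fin.zero ⌋ then x else zeroW) ⟩

update : ∀ {n V} → (Fin V → Word n) → Fin V → Word n → (Fin V → Word n)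
update s v w u = if ⌊ u Fin.≟ v ⌋ then w else s u

evalOp : ∀ {n V} → (Fin V → Word n) → Operand V → Word n
evalOp s (var u) = s u
evalOp s zeroC   = zeroW

compare : ∀ {n} → Cmp → Word n → Word n → Bool
compare eqC a b = ⌊ val a ≟ val b ⌋
compare neC a b = not ⌊ val a ≟ val b ⌋
compare ltC a b = ⌊ val a <? val b ⌋
compare leC a b = ⌊ val a ≤? val b ⌋

-- one instruction; nothing = the program halts
exec : ∀ {n V} → Instr V → Config n V → Maybe (Config n V)
exec (incI v)      ⟨ p , s ⟩ = just ⟨ suc p , update s v (inc (s v)) ⟩
exec (decI v)      ⟨ p , s ⟩ = just ⟨ suc p , update s v (dec (s v)) ⟩
exec (andI v a b)  ⟨ p , s ⟩ = just ⟨ suc p , update s v (s a ∧w s b) ⟩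
exec (orI v a b)   ⟨ p , s ⟩ = just ⟨ suc p , update s v (s a ∨w s b) ⟩
exec (assignI v a) ⟨ p , s ⟩ = just ⟨ suc p , update s v (evalOp s a) ⟩
exec (jumpIf c a b l) ⟨ p , s ⟩ =
  just ⟨ (if compare c (evalOp s a) (evalOp s b) then l else suc p) , s ⟩
exec (outputI v)   _ = nothing

-- instruction at address p (nothing if p is outside the program: halt)
fetch : ∀ {V} → Program V → ℕ → Maybe (Instr V)
fetch []       _       = nothing
fetch (i ∷ _)  zero    = just i
fetch (_ ∷ is) (suc p) = fetch is p

cost : ∀ {V} → Instr V → ℕ
cost (incI _) = 1
cost (decI _) = 1
cost _        = 0

-- Reach P x c i : configuration c occurs in the run of P on input x,
-- after exactly i increment/decrement operations have been executed.
data Reach {n V : ℕ} (P : Program (suc V)) (x : Word n)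
     : Config n (suc V) → ℕ → Set where
  start : Reach P x (initial x) 0
  next  : ∀ {c c' i ins} → Reach P x c i →
          fetch P (pc c) ≡ just ins →
          exec ins c ≡ just c' →
          Reach P x c' (i + cost ins)

zeroOnePow : ℕ → List Bool
zeroOnePow zero = []
zeroOnePow (suc m) = false ∷ true ∷ zeroOnePow m

kSeq : ℕ → ℕ → ℕ → ℕ
kSeq n m zero    = n
kSeq n m (suc j) = 2 * (m ∸ suc j) + 1

top : ∀ {n} → ℕ → Word n → List Bool
top k w = take k (toList w)

-- While an n-bit word is only combined bitwise with others, its top k bits stay in the
-- set {0ᵏ, 1ᵏ, x'}: this set contains the inputs 0 and x and is closed under bitwise AND
-- and OR. An increment can change the top j bits only through a carry from below, which
-- is stopped by any 0 of w at position j; a carry can cross all of 1ᵏ, but then it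
-- turns the top j bits into 0ʲ. Symmetrically a decrement is stopped by a 1. Since
-- x = e(01)ᵐdⁿ⁻²ᵐ⁻¹ has a 0 at position kᵢ₊₁ and a 1 at position kᵢ₊₁ + 1 (counting from 0
-- at the most significant bit), every increment or decrement keeps the invariant at the
-- price of two bits: kᵢ₊₁ + 2 ≤ kᵢ.
module Submission where

open import Defs
open import Data.Bool using (Bool; true; false; not; _∧_)
open import Data.Bool.Properties using (∧-comm; ∧-idem; ∧-zeroʳ; ∨-comm; ∨-idem)
open import Data.Bool.ListAction using (and)
open import Data.Fin using (Fin; zero; suc)
import Data.Fin as Fin
open import Data.List using (List; []; _∷_; _++_; replicate; take; drop; head; length; map; zipWith)
open import Data.List.Properties
  using (∷-injectiveʳ; take-take; take-map; drop-map; map-replicate; length-take; zipWith-comm)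
open import Data.Maybe using (Maybe; just)
open import Data.Nat using (ℕ; zero; suc; _+_; _*_; _∸_; _<_; _≤_; _⊓_; s≤s; z≤n; z<s)
open import Data.Nat.Properties
  using (≤-refl; ≤-trans; <⇒≤; n≤1+n; m≤n+m; m≤n⇒m⊓n≡m; +-comm; +-suc; +-identityʳ; *-suc; +-∸-assoc; ∸-monoʳ-<)
open import Data.Product using (_×_; _,_; proj₁; proj₂)
open import Data.Sum using (_⊎_; inj₁; inj₂; map₂)
open import Data.Vec using ([]; _∷_; toList)
import Data.Vec as Vec
open import Data.Vec.Properties using (map-const; length-toList; toList-replicate)
open import Relation.Nullary using (yes; no)
open import Relation.Binary.PropositionalEquality using (_≡_; refl; sym; trans; cong; cong₂; subst; subst₂)

private
  variable
    A B : Set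
    n j k : ℕ

_‼_ : List A → ℕ → Maybe A
l ‼ j = head (drop j l)

take-take-≤ : (l : List A) → j ≤ k → take j (take k l) ≡ take j l
take-take-≤ {j = j} {k} l j≤k = trans (take-take j k l) (cong (λ i → take i l) (m≤n⇒m⊓n≡m j≤k))

take-replicate : ∀ {j k} (a : A) → j ≤ k → take j (replicate k a) ≡ replicate j a
take-replicate {j = zero}  a _         = refl
take-replicate {j = suc j} a (s≤s j≤k) = cong (a ∷_) (take-replicate a j≤k)

‼-take : ∀ j {k} (l : List A) → j < k → take k l ‼ j ≡ l ‼ j
‼-take j       []      (s≤s _)   = refl
‼-take zero    (a ∷ l) (s≤s _)   = refl
‼-take (suc j) (a ∷ l) (s≤s j<k) = ‼-take j l j<k

replicate-‼ : ∀ j {k} (a : A) → j < k → replicate k a ‼ j ≡ just a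
replicate-‼ zero    a (s≤s _)   = refl
replicate-‼ (suc j) a (s≤s j<k) = replicate-‼ j a j<k

prefix-‼ : ∀ {l p : List A} → j < k → take k l ≡ p → l ‼ j ≡ p ‼ j
prefix-‼ {j = j} {l = l} j<k refl = sym (‼-take j l j<k)

zipWith-absorbs : ∀ {f : A → B → A} {a k} (l : List B) →
  (∀ b → f a b ≡ a) → length l ≡ k → zipWith f (replicate k a) l ≡ replicate k a
zipWith-absorbs []      _       refl = refl
zipWith-absorbs (b ∷ l) absorbs refl = cong₂ _∷_ (absorbs b) (zipWith-absorbs l absorbs refl)

zipWith-neutral : ∀ {f : A → B → B} {a k} (l : List B) →
  (∀ b → f a b ≡ b) → length l ≡ k → zipWith f (replicate k a) l ≡ l
zipWith-neutral []      _       refl = refl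
zipWith-neutral (b ∷ l) neutral refl = cong₂ _∷_ (neutral b) (zipWith-neutral l neutral refl)

zipWith-idem : ∀ {f : A → A → A} (l : List A) → (∀ a → f a a ≡ a) → zipWith f l l ≡ l
zipWith-idem []      _    = refl
zipWith-idem (a ∷ l) idem = cong₂ _∷_ (idem a) (zipWith-idem l idem)

and-drop-false : ∀ j (l : List Bool) → and (drop j l) ≡ false → and l ≡ false
and-drop-false zero    l       h = h
and-drop-false (suc j) []      ()
and-drop-false (suc j) (b ∷ l) h = trans (cong (b ∧_) (and-drop-false j l h)) (∧-zeroʳ b)

and-drop-ones : ∀ j (l : List Bool) → take j l ≡ replicate j true → and (drop j l) ≡ and l
and-drop-ones zero    l           _ = refl
and-drop-ones (suc j) []          ()
and-drop-ones (suc j) (false ∷ l) ()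
and-drop-ones (suc j) (true ∷ l)  h = and-drop-ones j l (∷-injectiveʳ h)

head-false⇒and-false : (l : List Bool) → head l ≡ just false → and l ≡ false
head-false⇒and-false (false ∷ l) refl = refl

head-true⇒and-not-false : (l : List Bool) → head l ≡ just true → and (map not l) ≡ false
head-true⇒and-not-false (true ∷ l) refl = refl

length-top : k ≤ n → (w : Word n) → length (top k w) ≡ k
length-top {k} k≤n w =
  trans (length-take k (toList w)) (trans (cong (k ⊓_) (length-toList w)) (m≤n⇒m⊓n≡m k≤n))

top-replicate : k ≤ n → (a : Bool) → top k (Vec.replicate n a) ≡ replicate k a
top-replicate {k} {n} k≤n a = trans (cong (take k) (toList-replicate n a)) (take-replicate a k≤n)

top-zipWith : ∀ k (f : Bool → Bool → Bool) (a b : Word n) →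
  top k (Vec.zipWith f a b) ≡ zipWith f (top k a) (top k b)
top-zipWith zero    f a       b       = refl
top-zipWith (suc k) f []      []      = refl
top-zipWith (suc k) f (a ∷ v) (b ∷ w) = cong (f a b ∷_) (top-zipWith k f v w)

top-inc : ∀ j (w : Word n) → and (drop j (toList w)) ≡ false → top j (inc w) ≡ top j w
top-inc zero    w        _ = refl
top-inc (suc j) []       ()
top-inc (suc j) (b ∷ bs) h rewrite and-drop-false j (toList bs) h = cong (b ∷_) (top-inc j bs h)

top-dec : ∀ j (w : Word n) → and (drop j (map not (toList w))) ≡ false → top j (dec w) ≡ top j w
top-dec zero    w        _ = refl
top-dec (suc j) []       ()
top-dec (suc j) (b ∷ bs) h rewrite and-drop-false j (map not (toList bs)) h = cong (b ∷_) (top-dec j bs h)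

inc-ones : (w : Word n) → and (toList w) ≡ true → inc w ≡ zeroW
inc-ones []           _ = refl
inc-ones (true ∷ bs)  h rewrite h = cong (false ∷_) (map-const bs false)
inc-ones (false ∷ bs) ()

dec-zeros : (w : Word n) → and (map not (toList w)) ≡ true → dec w ≡ Vec.replicate n true
dec-zeros []           _ = refl
dec-zeros (false ∷ bs) h rewrite h = cong (true ∷_) (map-const bs true)
dec-zeros (true ∷ bs)  ()

ConstOr : ℕ → List Bool → List Bool → Set
ConstOr k t l = l ≡ replicate k false ⊎ (l ≡ replicate k true ⊎ l ≡ t)

Tame : ℕ → Word n → Word n → Set
Tame k x w = ConstOr k (top k x) (top k w)

replicate-ConstOr : ∀ {t} (a : Bool) → ConstOr k t (replicate k a)
replicate-ConstOr false = inj₁ refl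
replicate-ConstOr true  = inj₂ (inj₁ refl)

ConstOr-take : ∀ {t l} → j ≤ k → ConstOr k t l → ConstOr j (take j t) (take j l)
ConstOr-take j≤k (inj₁ refl)        = inj₁ (take-replicate false j≤k)
ConstOr-take j≤k (inj₂ (inj₁ refl)) = inj₂ (inj₁ (take-replicate true j≤k))
ConstOr-take j≤k (inj₂ (inj₂ refl)) = inj₂ (inj₂ refl)

Tame-mono : {x w : Word n} → j ≤ k → Tame k x w → Tame j x w
Tame-mono {x = x} {w} j≤k tame =
  subst₂ (ConstOr _) (take-take-≤ (toList x) j≤k) (take-take-≤ (toList w) j≤k) (ConstOr-take j≤k tame)

module _ {f : Bool → Bool → Bool}
         (comm : ∀ a b → f a b ≡ f b a) (idem : ∀ a → f a a ≡ a)
         (section : ∀ a → (∀ b → f a b ≡ a) ⊎ (∀ b → f a b ≡ b)) where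

  replicate-zipWith-ConstOr : ∀ {t l} a → length l ≡ k → ConstOr k t l →
    ConstOr k t (zipWith f (replicate k a) l)
  replicate-zipWith-ConstOr {l = l} a |l| h with section a
  ... | inj₁ absorbs = subst (ConstOr _ _) (sym (zipWith-absorbs l absorbs |l|)) (replicate-ConstOr a)
  ... | inj₂ neutral = subst (ConstOr _ _) (sym (zipWith-neutral l neutral |l|)) h

  zipWith-ConstOr : ∀ {t l₁ l₂} → length t ≡ k → length l₂ ≡ k →
    ConstOr k t l₁ → ConstOr k t l₂ → ConstOr k t (zipWith f l₁ l₂)
  zipWith-ConstOr _   |l₂| (inj₁ refl)        h = replicate-zipWith-ConstOr false |l₂| h
  zipWith-ConstOr _   |l₂| (inj₂ (inj₁ refl)) h = replicate-zipWith-ConstOr true |l₂| h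
  zipWith-ConstOr {t = t} |t| _ (inj₂ (inj₂ refl)) (inj₁ refl) =
    subst (ConstOr _ _) (zipWith-comm f comm _ t) (replicate-zipWith-ConstOr false |t| (inj₂ (inj₂ refl)))
  zipWith-ConstOr {t = t} |t| _ (inj₂ (inj₂ refl)) (inj₂ (inj₁ refl)) =
    subst (ConstOr _ _) (zipWith-comm f comm _ t) (replicate-zipWith-ConstOr true |t| (inj₂ (inj₂ refl)))
  zipWith-ConstOr {t = t} _ _ (inj₂ (inj₂ refl)) (inj₂ (inj₂ refl)) = inj₂ (inj₂ (zipWith-idem t idem))

  Tame-zipWith : {x a b : Word n} → k ≤ n → Tame k x a → Tame k x b → Tame k x (Vec.zipWith f a b)
  Tame-zipWith {k = k} {x = x} {a} {b} k≤n ta tb =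
    subst (ConstOr k (top k x)) (sym (top-zipWith k f a b))
      (zipWith-ConstOr (length-top k≤n x) (length-top k≤n b) ta tb)

Tame-∧w : {x a b : Word n} → k ≤ n → Tame k x a → Tame k x b → Tame k x (a ∧w b)
Tame-∧w = Tame-zipWith ∧-comm ∧-idem λ { false → inj₁ (λ _ → refl) ; true → inj₂ (λ _ → refl) }

Tame-∨w : {x a b : Word n} → k ≤ n → Tame k x a → Tame k x b → Tame k x (a ∨w b)
Tame-∨w = Tame-zipWith ∨-comm ∨-idem λ { false → inj₂ (λ _ → refl) ; true → inj₁ (λ _ → refl) }

top-prefix : ∀ {p} (w : Word n) → j ≤ k → top k w ≡ p → top j w ≡ take j p
top-prefix w j≤k refl = sym (take-take-≤ (toList w) j≤k)

top-inc-ones : j ≤ n → (w : Word n) → top j w ≡ replicate j true →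
  top j (inc w) ≡ replicate j false ⊎ top j (inc w) ≡ replicate j true
top-inc-ones {j} j≤n w ones with and (toList w) in all-ones
... | true  = inj₁ (trans (cong (top j) (inc-ones w all-ones)) (top-replicate j≤n false))
... | false = inj₂ (trans (top-inc j w (trans (and-drop-ones j _ ones) all-ones)) ones)

top-dec-zeros : j ≤ n → (w : Word n) → top j w ≡ replicate j false →
  top j (dec w) ≡ replicate j false ⊎ top j (dec w) ≡ replicate j true
top-dec-zeros {j} j≤n w zeros with and (map not (toList w)) in all-zeros
... | true  = inj₂ (trans (cong (top j) (dec-zeros w all-zeros)) (top-replicate j≤n true))
... | false = inj₁ (trans (top-dec j w (trans (and-drop-ones j _ ones) all-zeros)) zeros)
  where
  ones : take j (map not (toList w)) ≡ replicate j true
  ones = trans (take-map j (toList w)) (trans (cong (map not) zeros) (map-replicate not j false))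

Tame-inc-kept : {x w : Word n} → j ≤ k → toList w ‼ j ≡ just false → Tame k x w → Tame j x (inc w)
Tame-inc-kept {j = j} {w = w} j≤k w‼j tame =
  subst (ConstOr _ _) (sym (top-inc j w (head-false⇒and-false _ w‼j))) (Tame-mono j≤k tame)

Tame-dec-kept : {x w : Word n} → j ≤ k → toList w ‼ j ≡ just true → Tame k x w → Tame j x (dec w)
Tame-dec-kept {j = j} {w = w} j≤k w‼j tame =
  subst (ConstOr _ _) (sym (top-dec j w bits)) (Tame-mono j≤k tame)
  where
  bits : and (drop j (map not (toList w))) ≡ false
  bits = trans (cong and (drop-map j (toList w))) (head-true⇒and-not-false _ w‼j)

Tame-inc : {x w : Word n} → k ≤ n → j < k → toList x ‼ j ≡ just false → Tame k x w → Tame j x (inc w)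
Tame-inc {j = j} _ j<k x‼j tame@(inj₁ zeros) =
  Tame-inc-kept (<⇒≤ j<k) (trans (prefix-‼ j<k zeros) (replicate-‼ j false j<k)) tame
Tame-inc {j = j} {x = x} _ j<k x‼j tame@(inj₂ (inj₂ same)) =
  Tame-inc-kept (<⇒≤ j<k) (trans (prefix-‼ j<k same) (trans (‼-take j (toList x) j<k) x‼j)) tame
Tame-inc {w = w} k≤n j<k _ (inj₂ (inj₁ ones)) =
  map₂ inj₁ (top-inc-ones (≤-trans (<⇒≤ j<k) k≤n) w
    (trans (top-prefix w (<⇒≤ j<k) ones) (take-replicate true (<⇒≤ j<k))))

Tame-dec : {x w : Word n} → k ≤ n → j < k → toList x ‼ j ≡ just true → Tame k x w → Tame j x (dec w)
Tame-dec {j = j} {x = x} _ j<k x‼j tame@(inj₂ (inj₂ same)) =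
  Tame-dec-kept (<⇒≤ j<k) (trans (prefix-‼ j<k same) (trans (‼-take j (toList x) j<k) x‼j)) tame
Tame-dec {j = j} _ j<k _ tame@(inj₂ (inj₁ ones)) =
  Tame-dec-kept (<⇒≤ j<k) (trans (prefix-‼ j<k ones) (replicate-‼ j true j<k)) tame
Tame-dec {w = w} k≤n j<k _ (inj₁ zeros) =
  map₂ inj₁ (top-dec-zeros (≤-trans (<⇒≤ j<k) k≤n) w
    (trans (top-prefix w (<⇒≤ j<k) zeros) (take-replicate false (<⇒≤ j<k))))

cost≤1 : ∀ {V} (ins : Instr V) → cost ins ≤ 1
cost≤1 (incI _)         = ≤-refl
cost≤1 (decI _)         = ≤-refl
cost≤1 (andI _ _ _)     = z≤n
cost≤1 (orI _ _ _)      = z≤n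
cost≤1 (assignI _ _)    = z≤n
cost≤1 (jumpIf _ _ _ _) = z≤n
cost≤1 (outputI _)      = z≤n

-- K i is the number of top bits controlled after i increments and decrements.
module Schedule {n m : ℕ} (x : Word n) (K : ℕ → ℕ) (K-start : K 0 ≤ n)
  (K-gap : ∀ {i} → suc i ≤ m → 2 + K (suc i) ≤ K i)
  (x-bits : ∀ {i} → suc i ≤ m →
     toList x ‼ K (suc i) ≡ just false × toList x ‼ suc (K (suc i)) ≡ just true)
  where

  K-shrink : ∀ {i} → suc i ≤ m → K (suc i) ≤ K i
  K-shrink i<m = ≤-trans (m≤n+m _ 2) (K-gap i<m)

  K-≤ : ∀ {i} → i ≤ m → K i ≤ n
  K-≤ {zero}  _   = K-start
  K-≤ {suc i} i<m = ≤-trans (K-shrink i<m) (K-≤ (<⇒≤ i<m))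

  AllTame : ∀ {V} → ℕ → (Fin V → Word n) → Set
  AllTame k s = ∀ v → Tame k x (s v)

  AllTame-update : ∀ {V k} {s : Fin V → Word n} {u w} →
    AllTame k s → Tame k x w → AllTame k (update s u w)
  AllTame-update {u = u} tame tame-w v with v Fin.≟ u
  ... | yes _ = tame-w
  ... | no  _ = tame v

  initial-Tame : ∀ {V} → AllTame (K 0) (store (initial {V = V} x))
  initial-Tame zero    = inj₂ (inj₂ refl)
  initial-Tame (suc v) = inj₁ (top-replicate K-start false)

  free-step : ∀ {V k} (ins : Instr V) {c c'} → cost ins ≡ 0 → k ≤ n → exec ins c ≡ just c' →
    AllTame k (store c) → AllTame k (store c')
  free-step (andI u a b)     _ k≤n refl tame = AllTame-update tame (Tame-∧w k≤n (tame a) (tame b))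
  free-step (orI u a b)      _ k≤n refl tame = AllTame-update tame (Tame-∨w k≤n (tame a) (tame b))
  free-step (assignI u (var a)) _ _ refl tame = AllTame-update tame (tame a)
  free-step (assignI u zeroC)   _ k≤n refl tame = AllTame-update tame (inj₁ (top-replicate k≤n false))
  free-step (jumpIf _ _ _ _) _ _   refl tame = tame
  free-step (outputI _)      _ _   ()

  costly-step : ∀ {V i} (ins : Instr V) {c c'} → cost ins ≡ 1 → suc i ≤ m → exec ins c ≡ just c' →
    AllTame (K i) (store c) → AllTame (K (suc i)) (store c')
  costly-step (incI u) _ i<m refl tame =
    AllTame-update (λ v → Tame-mono (K-shrink i<m) (tame v))
      (Tame-inc (K-≤ (<⇒≤ i<m)) (≤-trans (n≤1+n _) (K-gap i<m)) (proj₁ (x-bits i<m)) (tame u))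
  costly-step (decI u) _ i<m refl tame =
    AllTame-update (λ v → Tame-mono (K-shrink i<m) (tame v))
      (Tame-mono (n≤1+n _) (Tame-dec (K-≤ (<⇒≤ i<m)) (K-gap i<m) (proj₂ (x-bits i<m)) (tame u)))

  reach-Tame : ∀ {V} {P : Program (suc V)} {c i} → Reach P x c i → i ≤ m → AllTame (K i) (store c)
  reach-Tame start _ = initial-Tame
  reach-Tame (next {i = i} {ins = ins} run _ exec≡) le with cost ins in cost≡ | cost≤1 ins
  ... | zero | _ rewrite +-identityʳ i =
    free-step ins cost≡ (K-≤ le) exec≡ (reach-Tame run le)
  ... | suc zero | _ rewrite +-comm i 1 =
    costly-step ins cost≡ le exec≡ (reach-Tame run (<⇒≤ le))
  ... | suc (suc _) | s≤s ()

zeroOnePow-‼ : ∀ {u m} (r : List Bool) → u < m →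
  (zeroOnePow m ++ r) ‼ (2 * u) ≡ just false × (zeroOnePow m ++ r) ‼ suc (2 * u) ≡ just true
zeroOnePow-‼ {zero}  r (s≤s _)   = refl , refl
zeroOnePow-‼ {suc u} r (s≤s u<m) rewrite +-suc u (u + 0) = zeroOnePow-‼ r u<m

kSeq-gap : ∀ {n m i} → 2 * m < n → suc i ≤ m → 2 + kSeq n m (suc i) ≤ kSeq n m i
kSeq-gap {m = suc m} {zero} 2m<n _ rewrite +-comm (2 * m) 1 | *-suc 2 m = 2m<n
kSeq-gap {m = m} {suc i} _ i<m
  rewrite +-∸-assoc 1 i<m | +-suc (m ∸ suc (suc i)) (m ∸ suc (suc i) + 0) = ≤-refl

kSeq-bits : ∀ {n m e d i} (x : Word n) → toList x ≡ e ∷ (zeroOnePow m ++ replicate (n ∸ (2 * m + 1)) d) →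
  suc i ≤ m → toList x ‼ kSeq n m (suc i) ≡ just false × toList x ‼ suc (kSeq n m (suc i)) ≡ just true
kSeq-bits {m = m} {i = i} x x≡ i<m rewrite x≡ | +-comm (2 * (m ∸ suc i)) 1 =
  zeroOnePow-‼ _ (∸-monoʳ-< z<s i<m)

lemma1 : (n m : ℕ) (e d : Bool) → 1 ≤ n → 2 * m < n →
    (x : Word n) →
    toList x ≡ e ∷ (zeroOnePow m ++ replicate (n ∸ (2 * m + 1)) d) →
    {V : ℕ} (P : Program (suc V)) (c : Config n (suc V)) (i : ℕ) →
    Reach P x c i → i ≤ m → (v : Fin (suc V)) →
    top (kSeq n m i) (store c v) ≡ replicate (kSeq n m i) false
    ⊎ (top (kSeq n m i) (store c v) ≡ replicate (kSeq n m i) true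
    ⊎ top (kSeq n m i) (store c v) ≡ top (kSeq n m i) x)
lemma1 n m e d _ 2m<n x x≡ P c i run i≤m =
  Schedule.reach-Tame x (kSeq n m) ≤-refl (kSeq-gap 2m<n) (kSeq-bits x x≡) run i≤m
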